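{- Let $G$ be a neighborhood perfect graph and let $k \in \mathbb{N}_0$. Then $G$ is $F(\omega,k)$-free if and only if $G$ is $F(\chi,k)$-free.
   Context: All graphs are finite and simple. A graph is perfect if $\omega(H)=\chi(H)$ for each of its induced subgraphs $H$; a graph is neighborhood perfect if for every vertex $v$ the subgraph induced by the neighborhood $N(v)$ is perfect. For a set $\mathcal F$ of graphs, $G$ is $\mathcal F$-free if no induced subgraph of $G$ is isomorphic to a member of $\mathcal F$. $\Delta,\omega,\chi$ denote maximum degree, clique number, chromatic number. For $k\in\mathbb{N}_0$: $\varOmega_k$ is the class of graphs $G$ such that every induced subgraph $H$ of $G$ (including $G$) satisfies $\Delta(H)\le\omega(H)+k-1$; $\varUpsilon_k$ is the class of graphs $G$ such that every induced subgraph $H$ of $G$ (including $G$) satisfies $\Delta(H)\le\chi(H)+k-1$. $F(\omega,k)$ (resp. $F(\chi,k)$) is the set of minimal forbidden induced subgraphs of $\varOmega_k$ (resp. $\varUpsilon_k$): graphs not in the class all of whose proper induced subgraphs are in the class. -}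

module Defs where

open import Data.Nat using (ℕ; zero; suc; _+_; _≤_; _<_)
open import Data.Fin using (Fin)
open import Data.Bool using (Bool; true; false; if_then_else_)
open import Data.List using (List; map; allFin)
open import Data.Nat.ListAction using (sum)
open import Data.Product using (Σ; ∃; _×_; _,_)
open import Relation.Binary.PropositionalEquality using (_≡_; _≢_)
open import Relation.Nullary using (¬_)
open import Function.Definitions using (Injective)

record Graph : Set where
  field
    n      : ℕ
    adj    : Fin n → Fin n → Bool
    sym    : ∀ i j → adj i j ≡ adj j i
    irrefl : ∀ i → adj i i ≡ false
open Graph public

-- The subgraph of G induced by the image of f (f injective),
-- with vertices relabelled by Fin m.
induce : (G : Graph) {m : ℕ} → (Fin m → Fin (n G)) → Graph
induce G {m} f = record
  { n = m
  ; adj = λ i j → adj G (f i) (f j)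
  ; sym = λ i j → sym G (f i) (f j)
  ; irrefl = λ i → irrefl G (f i)
  }

degree : (G : Graph) → Fin (n G) → ℕ
degree G v = sum (map (λ j → if adj G v j then 1 else 0) (allFin (n G)))

HasClique : Graph → ℕ → Set
HasClique G w = Σ (Fin w → Fin (n G)) λ c →
  Injective _≡_ _≡_ c × (∀ i j → i ≢ j → adj G (c i) (c j) ≡ true)

IsCliqueNumber : Graph → ℕ → Set
IsCliqueNumber G w = HasClique G w × ¬ HasClique G (suc w)

Colourable : Graph → ℕ → Set
Colourable G c = Σ (Fin (n G) → Fin c) λ col →
  ∀ i j → adj G i j ≡ true → col i ≢ col j

IsChromaticNumber : Graph → ℕ → Set
IsChromaticNumber G c = Colourable G c × (∀ c' → c' < c → ¬ Colourable G c')

-- Every induced subgraph of G whose vertices all satisfy S has ω = χ.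
-- (PerfectOn G S  says that G[S] is perfect.)
PerfectOn : (G : Graph) → (Fin (n G) → Set) → Set
PerfectOn G S = ∀ m (f : Fin m → Fin (n G)) → Injective _≡_ _≡_ f →
  (∀ i → S (f i)) →
  ∀ w → IsCliqueNumber (induce G f) w → IsChromaticNumber (induce G f) w

NeighbourhoodPerfect : Graph → Set
NeighbourhoodPerfect G = ∀ v → PerfectOn G (λ u → adj G v u ≡ true)

_≤ind_ : Graph → Graph → Set
F ≤ind G = Σ (Fin (n F) → Fin (n G)) λ f →
  Injective _≡_ _≡_ f × (∀ i j → adj G (f i) (f j) ≡ adj F i j)

-- Condition Δ(H) ≤ ω(H) + k - 1, written as Δ(H) + 1 ≤ ω(H) + k
-- (i.e. every vertex degree d satisfies d + 1 ≤ ω + k).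
ΔωCond : ℕ → Graph → Set
ΔωCond k H = ∀ w → IsCliqueNumber H w → ∀ v → degree H v + 1 ≤ w + k

ΔχCond : ℕ → Graph → Set
ΔχCond k H = ∀ c → IsChromaticNumber H c → ∀ v → degree H v + 1 ≤ c + k

Hereditarily : (Graph → Set) → Graph → Set
Hereditarily P G = ∀ m (f : Fin m → Fin (n G)) → Injective _≡_ _≡_ f →
  P (induce G f)

Ω : ℕ → Graph → Set
Ω k = Hereditarily (ΔωCond k)

Υ : ℕ → Graph → Set
Υ k = Hereditarily (ΔχCond k)

MinForbidden : (Graph → Set) → Graph → Set
MinForbidden 𝒞 F = ¬ 𝒞 F × (∀ m (f : Fin m → Fin (n F)) → Injective _≡_ _≡_ f →
  m < n F → 𝒞 (induce F f))

Fω : ℕ → Graph → Set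
Fω k = MinForbidden (Ω k)

Fχ : ℕ → Graph → Set
Fχ k = MinForbidden (Υ k)

Free : (Graph → Set) → Graph → Set
Free 𝓕 G = ∀ F → 𝓕 F → ¬ (F ≤ind G)

-- Since ω ≤ χ, every graph in Ω_k lies in Υ_k.  Conversely, let H be
-- neighbourhood perfect with H ∈ Υ_k and let v be a vertex of H.  In the
-- closed neighbourhood H[v ∪ N(v)] the apex v adds one to both the clique
-- number and (by perfection of N(v)) the chromatic number of H[N(v)], so
--   deg v + 1 ≤ χ(H[v ∪ N(v)]) + k = ω(H[N(v)]) + 1 + k ≤ ω(H) + k.
-- As neighbourhood perfection is inherited by induced subgraphs, Ω_k and
-- Υ_k coincide on all induced subgraphs of G, and therefore so do their
-- minimal forbidden induced subgraphs that occur in G.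
module Submission where

open import Defs
open import Data.Nat using (ℕ; zero; suc; _+_; _≤_; _<_; _≤?_; _<?_)
open import Data.Nat.Properties
  using (≮⇒≥; <⇒≱; ≤-refl; ≤-trans; +-monoˡ-≤; +-identityʳ; +-suc; module ≤-Reasoning)
open import Data.Fin using (Fin; zero; suc; fromℕ; inject₁; inject≤)
open import Data.Fin.Properties
  using (pigeonhole; fromℕ≢inject₁; inject₁-injective; inject≤-injective; suc-injective)
  renaming (<⇒≢ to <⇒≢ᶠ)
open import Data.Bool using (true; if_then_else_) renaming (_≟_ to _≟ᵇ_)
open import Data.Bool.Properties using (¬-not)
open import Data.List using (List; []; _∷_; map; filter; allFin; tabulate; lookup; length)
open import Data.List.Properties using (map-tabulate; tabulate-lookup)
open import Data.Nat.ListAction using (sum)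
import Data.List.Relation.Unary.All as All
open import Data.List.Relation.Unary.All.Properties using (all-filter)
open import Data.List.Relation.Unary.AllPairs using (_∷_)
open import Data.List.Relation.Unary.Unique.Propositional using (Unique)
import Data.List.Relation.Unary.Unique.Propositional.Properties as Unique
open import Data.List.Membership.Propositional.Properties using (∈-lookup)
open import Data.Vec.Functional using () renaming (_∷_ to _◂_)
open import Data.Product using (∃; _×_; _,_; proj₁)
open import Data.Empty using (⊥-elim)
open import Relation.Binary.PropositionalEquality
  using (_≡_; _≢_; refl; cong; cong₂; trans; subst; module ≡-Reasoning)
  renaming (sym to ≡-sym)
open import Relation.Nullary using (¬_; yes; no)
open import Relation.Nullary.Decidable using (decidable-stable; ¬¬-excluded-middle)
open import Relation.Unary using (Decidable)
open import Function.Bundles using (_⇔_; mk⇔)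
open import Function.Definitions using (Injective)
open import Function using (_∘_; id)

-- Inequalities between naturals are ¬¬-stable, so they may be proved while
-- assuming a (classically existing) clique number.
≤-stable : ∀ {a b} → ¬ ¬ (a ≤ b) → a ≤ b
≤-stable = decidable-stable (_ ≤? _)

-- A property of naturals holding at 0 and bounded above has, not-not, a
-- largest witness.  This is how the clique number is obtained.
¬¬-largest : (P : ℕ → Set) (N : ℕ) → (∀ {j} → P j → j ≤ N) → P 0 →
             ¬ ¬ (∃ λ w → P w × ¬ P (suc w))
¬¬-largest P N bounded P0 = climb (suc N) 0 P0 ≤-refl
  where
  -- Starting from a witness j, at most b further steps up can succeed.
  climb : ∀ b j → P j → N < j + b → ¬ ¬ (∃ λ w → P w × ¬ P (suc w))
  climb zero    j Pj N<j _ = <⇒≱ (subst (N <_) (+-identityʳ j) N<j) (bounded Pj)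
  climb (suc b) j Pj N<j+b+1 found = ¬¬-excluded-middle λ where
    (yes Pj+1) → climb b (suc j) Pj+1 (subst (N <_) (+-suc j b) N<j+b+1) found
    (no ¬Pj+1) → found (j , Pj , ¬Pj+1)

◂-injective : ∀ {A : Set} {m} {x : A} {f : Fin m → A} →
              Injective _≡_ _≡_ f → (∀ i → x ≢ f i) → Injective _≡_ _≡_ (x ◂ f)
◂-injective f-inj fresh {zero}  {zero}  _  = refl
◂-injective f-inj fresh {zero}  {suc j} eq = ⊥-elim (fresh j eq)
◂-injective f-inj fresh {suc i} {zero}  eq = ⊥-elim (fresh i (≡-sym eq))
◂-injective f-inj fresh {suc i} {suc j} eq = cong suc (f-inj eq)

lookup-injective : ∀ {A : Set} {xs : List A} → Unique xs → Injective _≡_ _≡_ (lookup xs)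
lookup-injective (x∉xs ∷ xs-unique) {zero}  {zero}  _  = refl
lookup-injective (x∉xs ∷ xs-unique) {zero}  {suc j} eq = ⊥-elim (All.lookup x∉xs (∈-lookup j) eq)
lookup-injective (x∉xs ∷ xs-unique) {suc i} {zero}  eq =
  ⊥-elim (All.lookup x∉xs (∈-lookup i) (≡-sym eq))
lookup-injective (x∉xs ∷ xs-unique) {suc i} {suc j} eq = cong suc (lookup-injective xs-unique eq)

sum-map-filter : ∀ {A : Set} {P : A → Set} (P? : Decidable P) (h : A → ℕ) →
                 (∀ x → ¬ P x → h x ≡ 0) →
                 ∀ xs → sum (map h (filter P? xs)) ≡ sum (map h xs)
sum-map-filter P? h vanish [] = refl
sum-map-filter P? h vanish (x ∷ xs) with P? x
... | yes _  = cong (h x +_) (sum-map-filter P? h vanish xs)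
... | no ¬Px = trans (sum-map-filter P? h vanish xs)
                     (cong (_+ sum (map h xs)) (≡-sym (vanish x ¬Px)))

induce-≤ind : (G : Graph) {m : ℕ} (f : Fin m → Fin (n G)) →
              Injective _≡_ _≡_ f → induce G f ≤ind G
induce-≤ind G f f-inj = f , f-inj , λ i j → refl

≤ind-trans : ∀ F G H → F ≤ind G → G ≤ind H → F ≤ind H
≤ind-trans F G H (e , e-inj , e-adj) (d , d-inj , d-adj) =
  d ∘ e , e-inj ∘ d-inj , λ i j → trans (d-adj (e i) (e j)) (e-adj i j)

restrict-≤ind : ∀ F G ((e , _ , _) : F ≤ind G) {m} (f : Fin m → Fin (n F)) →
                induce F f ≤ind induce G (e ∘ f)
restrict-≤ind F G (e , _ , e-adj) f = id , id , λ i j → e-adj (f i) (f j)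

unrestrict-≤ind : ∀ F G ((e , _ , _) : F ≤ind G) {m} (f : Fin m → Fin (n F)) →
                  induce G (e ∘ f) ≤ind induce F f
unrestrict-≤ind F G (e , _ , e-adj) f = id , id , λ i j → ≡-sym (e-adj (f i) (f j))

clique-≤ind : ∀ F G {w} → F ≤ind G → HasClique F w → HasClique G w
clique-≤ind F G (e , e-inj , e-adj) (c , c-inj , c-adj) =
  e ∘ c , c-inj ∘ e-inj , λ i j i≢j → trans (e-adj (c i) (c j)) (c-adj i j i≢j)

colouring-≤ind : ∀ F G {c} → F ≤ind G → Colourable G c → Colourable F c
colouring-≤ind F G (e , _ , e-adj) (col , col-proper) =
  col ∘ e , λ i j a → col-proper (e i) (e j) (trans (e-adj i j) a)

clique≤colours : ∀ X {w c} → HasClique X w → Colourable X c → w ≤ c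
clique≤colours X {w} {c} (cl , _ , cl-adj) (col , col-proper) with c <? w
... | no c≮w = ≮⇒≥ c≮w
... | yes c<w with pigeonhole c<w (col ∘ cl)
... | i , j , i<j , same = ⊥-elim (col-proper (cl i) (cl j) (cl-adj i j (<⇒≢ᶠ i<j)) same)

adjacent⇒distinct : (X : Graph) {i j : Fin (n X)} → adj X i j ≡ true → i ≢ j
adjacent⇒distinct X {i} a refl with trans (≡-sym (irrefl X i)) a
... | ()

discrete-colouring : (X : Graph) → Colourable X (n X)
discrete-colouring X = id , λ i j → adjacent⇒distinct X

clique≤order : ∀ X {w} → HasClique X w → w ≤ n X
clique≤order X cl = clique≤colours X cl (discrete-colouring X)

empty-clique : (X : Graph) → HasClique X 0
empty-clique X = (λ ()) , (λ { {()} }) , (λ ())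

clique-shrink : ∀ X {i j} → i ≤ j → HasClique X j → HasClique X i
clique-shrink X i≤j (cl , cl-inj , cl-adj) =
  cl ∘ (λ a → inject≤ a i≤j) ,
  (λ eq → inject≤-injective i≤j i≤j _ _ (cl-inj eq)) ,
  λ a b a≢b → cl-adj _ _ (λ eq → a≢b (inject≤-injective i≤j i≤j a b eq))

clique≤cliqueNumber : ∀ X {w j} → IsCliqueNumber X w → HasClique X j → j ≤ w
clique≤cliqueNumber X {w} {j} (_ , no-larger) cl with w <? j
... | no w≮j = ≮⇒≥ w≮j
... | yes w<j = ⊥-elim (no-larger (clique-shrink X w<j cl))

cliqueNumber-exists : (X : Graph) → ¬ ¬ (∃ λ w → IsCliqueNumber X w)
cliqueNumber-exists X = ¬¬-largest (HasClique X) (n X) (clique≤order X) (empty-clique X)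

chromaticNumber-of-clique : ∀ X {c} → HasClique X c → Colourable X c → IsChromaticNumber X c
chromaticNumber-of-clique X cl col = col , λ c' c'<c col' → <⇒≱ c'<c (clique≤colours X cl col')

cliqueNumber-≤ind : ∀ X Y {w} → X ≤ind Y → Y ≤ind X → IsCliqueNumber X w → IsCliqueNumber Y w
cliqueNumber-≤ind X Y X≤Y Y≤X (cl , no-larger) =
  clique-≤ind X Y X≤Y cl , λ cl' → no-larger (clique-≤ind Y X Y≤X cl')

chromaticNumber-≤ind : ∀ X Y {c} → X ≤ind Y → Y ≤ind X →
                       IsChromaticNumber X c → IsChromaticNumber Y c
chromaticNumber-≤ind X Y X≤Y Y≤X (col , no-fewer) =
  colouring-≤ind Y X Y≤X col , λ c' c'<c col' → no-fewer c' c'<c (colouring-≤ind X Y X≤Y col')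

neighbourhoodPerfect-≤ind : ∀ F G → F ≤ind G → NeighbourhoodPerfect G → NeighbourhoodPerfect F
neighbourhoodPerfect-≤ind F G F≤G@(e , e-inj , e-adj) np v m f f-inj f-adj w ω=w =
  chromaticNumber-≤ind (induce G (e ∘ f)) (induce F f) G≤F F≤G′
    (np (e v) m (e ∘ f) (f-inj ∘ e-inj) (λ i → trans (e-adj v (f i)) (f-adj i)) w
      (cliqueNumber-≤ind (induce F f) (induce G (e ∘ f)) F≤G′ G≤F ω=w))
  where
  F≤G′ : induce F f ≤ind induce G (e ∘ f)
  F≤G′ = restrict-≤ind F G F≤G f
  G≤F : induce G (e ∘ f) ≤ind induce F f
  G≤F = unrestrict-≤ind F G F≤G f

module Apex (X : Graph) {p : ℕ} (f : Fin (suc p) → Fin (n X))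
            (apex : ∀ i → adj X (f zero) (f (suc i)) ≡ true) where

  apex-clique : ∀ {c} → HasClique (induce X (f ∘ suc)) c → HasClique (induce X f) (suc c)
  apex-clique (cl , cl-inj , cl-adj) =
    zero ◂ suc ∘ cl , ◂-injective (cl-inj ∘ suc-injective) (λ i ()) , extended-adj
    where
    extended-adj : ∀ i j → i ≢ j → adj X (f ((zero ◂ suc ∘ cl) i)) (f ((zero ◂ suc ∘ cl) j)) ≡ true
    extended-adj zero    zero    i≢j = ⊥-elim (i≢j refl)
    extended-adj zero    (suc j) _   = apex (cl j)
    extended-adj (suc i) zero    _   = trans (sym X (f (suc (cl i))) (f zero)) (apex (cl i))
    extended-adj (suc i) (suc j) i≢j = cl-adj i j (i≢j ∘ cong suc)

  apex-colouring : ∀ {c} → Colourable (induce X (f ∘ suc)) c → Colourable (induce X f) (suc c)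
  apex-colouring {c} (col , col-proper) = fromℕ c ◂ inject₁ ∘ col , extended-proper
    where
    extended-proper : ∀ i j → adj X (f i) (f j) ≡ true →
                      (fromℕ c ◂ inject₁ ∘ col) i ≢ (fromℕ c ◂ inject₁ ∘ col) j
    extended-proper zero    zero    a = λ _ → adjacent⇒distinct X a refl
    extended-proper zero    (suc j) _ = fromℕ≢inject₁
    extended-proper (suc i) zero    _ = fromℕ≢inject₁ ∘ ≡-sym
    extended-proper (suc i) (suc j) a = col-proper i j a ∘ inject₁-injective

-- The neighbourhood of a vertex v, enumerated without repetition by nb,
-- and the closed neighbourhood star = v ◂ nb with apex v.
module Neighbourhood (H : Graph) (v : Fin (n H)) where

  adjacent? : Decidable (λ u → adj H v u ≡ true)
  adjacent? u = adj H v u ≟ᵇ true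

  neighbours : List (Fin (n H))
  neighbours = filter adjacent? (allFin (n H))

  size : ℕ
  size = length neighbours

  nb : Fin size → Fin (n H)
  nb = lookup neighbours

  nb-adjacent : ∀ i → adj H v (nb i) ≡ true
  nb-adjacent i = All.lookup (all-filter adjacent? (allFin (n H))) (∈-lookup i)

  nb-injective : Injective _≡_ _≡_ nb
  nb-injective = lookup-injective (Unique.filter⁺ adjacent? (Unique.allFin⁺ (n H)))

  star : Fin (suc size) → Fin (n H)
  star = v ◂ nb

  star-injective : Injective _≡_ _≡_ star
  star-injective = ◂-injective nb-injective λ i → adjacent⇒distinct H (nb-adjacent i)

  star-degree : degree (induce H star) zero ≡ degree H v
  star-degree = begin
      indicator v + sum (map (indicator ∘ star) (tabulate suc))
    ≡⟨ cong₂ _+_ (cong (λ b → if b then 1 else 0) (irrefl H v))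
                 (cong sum (map-tabulate suc (indicator ∘ star))) ⟩
      sum (tabulate (indicator ∘ lookup neighbours))
    ≡⟨ cong sum (≡-sym (map-tabulate (lookup neighbours) indicator)) ⟩
      sum (map indicator (tabulate (lookup neighbours)))
    ≡⟨ cong (sum ∘ map indicator) (tabulate-lookup neighbours) ⟩
      sum (map indicator neighbours)
    ≡⟨ sum-map-filter adjacent? indicator
         (λ u ¬adj → cong (λ b → if b then 1 else 0) (¬-not ¬adj)) (allFin (n H)) ⟩
      degree H v
    ∎
    where
    open ≡-Reasoning
    indicator : Fin (n H) → ℕ
    indicator u = if adj H v u then 1 else 0

-- Ω_k ⊆ Υ_k holds for every graph, because ω ≤ χ.
Ω⊆Υ : ∀ k X → Ω k X → Υ k X
Ω⊆Υ k X ω-cond m f f-inj c χ=c v = ≤-stable λ goal →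
  cliqueNumber-exists (induce X f) λ (w , ω=w) →
    goal (≤-trans (ω-cond m f f-inj w ω=w v)
                  (+-monoˡ-≤ k (clique≤colours (induce X f) (proj₁ ω=w) (proj₁ χ=c))))

-- The degree bound: a neighbourhood perfect graph in Υ_k satisfies
-- Δ + 1 ≤ ω + k, by applying the Υ_k condition to a closed neighbourhood.
degree-bound : ∀ k H → NeighbourhoodPerfect H → Υ k H → ΔωCond k H
degree-bound k H np υ w ω=w v = ≤-stable λ goal →
  cliqueNumber-exists (induce H nb) λ (w₀ , ωN=w₀) → goal (bound w₀ ωN=w₀)
  where
  open Neighbourhood H v
  open Apex H star nb-adjacent
  bound : ∀ w₀ → IsCliqueNumber (induce H nb) w₀ → degree H v + 1 ≤ w + k
  bound w₀ ωN=w₀ = begin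
      degree H v + 1                     ≡⟨ cong (_+ 1) star-degree ⟨
      degree (induce H star) zero + 1    ≤⟨ υ (suc size) star star-injective (suc w₀) χ-star zero ⟩
      suc w₀ + k                         ≤⟨ +-monoˡ-≤ k (clique≤cliqueNumber H ω=w clique-H) ⟩
      w + k                              ∎
    where
    open ≤-Reasoning
    χN=w₀ : IsChromaticNumber (induce H nb) w₀
    χN=w₀ = np v size nb nb-injective nb-adjacent w₀ ωN=w₀
    clique-star : HasClique (induce H star) (suc w₀)
    clique-star = apex-clique (proj₁ ωN=w₀)
    χ-star : IsChromaticNumber (induce H star) (suc w₀)
    χ-star = chromaticNumber-of-clique (induce H star) clique-star (apex-colouring (proj₁ χN=w₀))
    clique-H : HasClique H (suc w₀)
    clique-H = clique-≤ind (induce H star) H (induce-≤ind H star star-injective) clique-star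

-- For neighbourhood perfect graphs Υ_k ⊆ Ω_k: apply the degree bound to
-- every induced subgraph, which is again neighbourhood perfect and in Υ_k.
Υ⊆Ω : ∀ k H → NeighbourhoodPerfect H → Υ k H → Ω k H
Υ⊆Ω k H np υ m f f-inj =
  degree-bound k (induce H f)
    (neighbourhoodPerfect-≤ind (induce H f) H (induce-≤ind H f f-inj) np)
    (λ m' g g-inj → υ m' (f ∘ g) (g-inj ∘ f-inj))

minForbidden-transfer : (G : Graph) (𝒞 𝒟 : Graph → Set) →
                        (∀ X → X ≤ind G → 𝒞 X → 𝒟 X) → (∀ X → X ≤ind G → 𝒟 X → 𝒞 X) →
                        ∀ F → F ≤ind G → MinForbidden 𝒞 F → MinForbidden 𝒟 F
minForbidden-transfer G 𝒞 𝒟 𝒞⊆𝒟 𝒟⊆𝒞 F F≤G (F∉𝒞 , proper∈𝒞) =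
  (λ F∈𝒟 → F∉𝒞 (𝒟⊆𝒞 F F≤G F∈𝒟)) ,
  λ m f f-inj m<n →
    𝒞⊆𝒟 _ (≤ind-trans (induce F f) F G (induce-≤ind F f f-inj) F≤G) (proper∈𝒞 m f f-inj m<n)

free-transfer : ∀ {𝓕 𝓖 : Graph → Set} (G : Graph) →
                (∀ F → F ≤ind G → 𝓕 F → 𝓖 F) → Free 𝓖 G → Free 𝓕 G
free-transfer G 𝓕⊆𝓖 free F F∈𝓕 F≤G = free F (𝓕⊆𝓖 F F≤G F∈𝓕) F≤G

lemma2 : (G : Graph) (k : ℕ) → NeighbourhoodPerfect G →
    (Free (Fω k) G ⇔ Free (Fχ k) G)
lemma2 G k np = mk⇔
  (free-transfer G (minForbidden-transfer G (Υ k) (Ω k) Υ⊆Ω-in-G Ω⊆Υ-in-G))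
  (free-transfer G (minForbidden-transfer G (Ω k) (Υ k) Ω⊆Υ-in-G Υ⊆Ω-in-G))
  where
  Ω⊆Υ-in-G : ∀ X → X ≤ind G → Ω k X → Υ k X
  Ω⊆Υ-in-G X _ = Ω⊆Υ k X
  Υ⊆Ω-in-G : ∀ X → X ≤ind G → Υ k X → Ω k X
  Υ⊆Ω-in-G X X≤G = Υ⊆Ω k X (neighbourhoodPerfect-≤ind X G X≤G np)
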